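{- Let $n\ge1$ be an integer and $N=2^n$. Then $Q(N,N/2)-H(N,N/2)=N\frac{\log_2N-4}{2}+\log_2N+2$.
   Context: For a power of two $m$, let $O(m)=\frac{m}{4}(\log_2^2m-\log_2m+4)-1$ (the number of comparators of Batcher's odd-even sorting network on $m$ inputs). For powers of two $1\le K\le N$ define $H(N,K)$ (the number of comparators of the improved pairwise selection network $pw\_hbit\_sel^N_K$) by: $H(N,1)=N-1$; $H(N,N)=O(N)$ for $N>1$; and for $1<K<N$, $H(N,K)=H(N/2,K)+H(N/2,K/2)+\frac N2+\frac{K\log_2K}{2}$. Define $Q(N,K)$ (the number of comparators of the pairwise selection network $pw\_sel^N_K$ of Codish and Zazon-Ivry) by the same recursion with the term $\frac{K\log_2 K}{2}$ replaced by $K\log_2K-K+1$: $Q(N,1)=N-1$, $Q(N,N)=O(N)$ for $N>1$, and $Q(N,K)=Q(N/2,K)+Q(N/2,K/2)+\frac N2+K\log_2K-K+1$ for $1<K<N$. -}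

module Defs where

open import Data.Nat using (ℕ; zero; suc; _^_; _≡ᵇ_)
open import Data.Bool using (if_then_else_)
open import Data.Integer using (+_)
open import Data.Rational using (ℚ; _/_; _+_; _-_; _*_)

ℕ→ℚ : ℕ → ℚ
ℕ→ℚ m = + m / 1

-- Powers of two are indexed by their exponents: N = 2^n, K = 2^k,
-- so log₂ N = n and log₂ K = k.

-- O(2^n) = (2^n / 4) (n² - n + 4) - 1   (Batcher's odd-even network)
O : ℕ → ℚ
O n = (ℕ→ℚ (2 ^ n) * (+ 1 / 4)) * ((ℕ→ℚ n * ℕ→ℚ n - ℕ→ℚ n) + ℕ→ℚ 4) - ℕ→ℚ 1

-- Hexp n k = H(2^n, 2^k), meaningful for k ≤ n (other values are junk).
-- H(N,1) = N - 1 ; H(N,N) = O(N) for N > 1 ;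
-- H(N,K) = H(N/2,K) + H(N/2,K/2) + N/2 + K log₂ K / 2 for 1 < K < N.
Hexp : ℕ → ℕ → ℚ
Hexp n zero = ℕ→ℚ (2 ^ n) - ℕ→ℚ 1
Hexp zero (suc k) = ℕ→ℚ 0
Hexp (suc n) (suc k) =
  if k ≡ᵇ n then O (suc n)
  else (Hexp n (suc k) + Hexp n k + ℕ→ℚ (2 ^ n)
        + (ℕ→ℚ (2 ^ suc k) * ℕ→ℚ (suc k)) * (+ 1 / 2))

-- Qexp n k = Q(2^n, 2^k): same recursion with K log₂ K - K + 1.
Qexp : ℕ → ℕ → ℚ
Qexp n zero = ℕ→ℚ (2 ^ n) - ℕ→ℚ 1
Qexp zero (suc k) = ℕ→ℚ 0
Qexp (suc n) (suc k) =
  if k ≡ᵇ n then O (suc n)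
  else (Qexp n (suc k) + Qexp n k + ℕ→ℚ (2 ^ n)
        + ((ℕ→ℚ (2 ^ suc k) * ℕ→ℚ (suc k) - ℕ→ℚ (2 ^ suc k)) + ℕ→ℚ 1))

module Submission where

open import Defs
open import Data.Nat using (ℕ; _^_; _≤_; _∸_)
open import Data.Integer using (+_)
open import Data.Rational using (ℚ; _/_; _+_; _-_; _*_)
open import Relation.Binary.PropositionalEquality using (_≡_)

open import Data.Bool using (true; false; T)
open import Data.Nat as ℕ using (zero; suc; _≡ᵇ_; s≤s)
open import Data.Nat.Coprimality using (Coprime)
open import Data.Nat.Divisibility using (∣1⇒≡1)
import Data.Nat.Properties as ℕ
import Data.Integer as ℤ
import Data.Integer.Properties as ℤ
open import Data.Product using (_,_)
open import Data.Rational using (mkℚ)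
open import Data.Rational.Properties using (normalize-coprime)
open import Data.Rational.Solver using (module +-*-Solver)
open import Relation.Binary.PropositionalEquality
  using (_≢_; refl; sym; cong; cong₂; subst; module ≡-Reasoning)
open import Relation.Nullary using (contradiction)

-- Q and H unfold (N, N/2) into the same diagonal term O(N/2), the values at
-- (N/2, N/4) and N/2; they differ only in the last summand.  Hence the gap
-- D(N) = Q(N,N/2) - H(N,N/2) satisfies D(2N) = D(N) + (N log N - N + 1) - N log N / 2,
-- a recurrence also satisfied by the closed form, and D(2) = 0.

open ≡-Reasoning
open +-*-Solver

coprime-1 : ∀ m → Coprime m 1
coprime-1 m (_ , d∣1) = ∣1⇒≡1 d∣1

ℕ→ℚ-mkℚ : ∀ m → ℕ→ℚ m ≡ mkℚ (+ m) 0 (coprime-1 m)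
ℕ→ℚ-mkℚ m = normalize-coprime (coprime-1 m)

ℕ→ℚ-+ : ∀ a b → ℕ→ℚ (a ℕ.+ b) ≡ ℕ→ℚ a + ℕ→ℚ b
ℕ→ℚ-+ a b = begin
  + (a ℕ.+ b) / 1                              ≡⟨ cong (_/ 1) (ℤ.pos-+ a b) ⟩
  (+ a ℤ.+ + b) / 1                            ≡⟨ cong (_/ 1) (sym (cong₂ ℤ._+_ (ℤ.*-identityʳ (+ a)) (ℤ.*-identityʳ (+ b)))) ⟩
  (+ a ℤ.* + 1 ℤ.+ + b ℤ.* + 1) / 1            ≡⟨ sym (cong₂ _+_ (ℕ→ℚ-mkℚ a) (ℕ→ℚ-mkℚ b)) ⟩
  ℕ→ℚ a + ℕ→ℚ b                                ∎

ℕ→ℚ-* : ∀ a b → ℕ→ℚ (a ℕ.* b) ≡ ℕ→ℚ a * ℕ→ℚ b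
ℕ→ℚ-* a b = begin
  + (a ℕ.* b) / 1      ≡⟨ cong (_/ 1) (ℤ.pos-* a b) ⟩
  (+ a ℤ.* + b) / 1    ≡⟨ sym (cong₂ _*_ (ℕ→ℚ-mkℚ a) (ℕ→ℚ-mkℚ b)) ⟩
  ℕ→ℚ a * ℕ→ℚ b        ∎

≡ᵇ-refl : ∀ n → (n ≡ᵇ n) ≡ true
≡ᵇ-refl zero    = refl
≡ᵇ-refl (suc n) = ≡ᵇ-refl n

≢⇒≡ᵇ-false : ∀ {k n} → k ≢ n → (k ≡ᵇ n) ≡ false
≢⇒≡ᵇ-false {k} {n} k≢n with k ≡ᵇ n in eq
... | true  = contradiction (ℕ.≡ᵇ⇒≡ k n (subst T (sym eq) _)) k≢n
... | false = refl

Qexp-diagonal≡Hexp-diagonal : ∀ n → Qexp n n ≡ Hexp n n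
Qexp-diagonal≡Hexp-diagonal zero = refl
Qexp-diagonal≡Hexp-diagonal (suc n) rewrite ≡ᵇ-refl n = refl

hbitTerm : ℕ → ℚ
hbitTerm k = (ℕ→ℚ (2 ^ k) * ℕ→ℚ k) * (+ 1 / 2)

pairwiseTerm : ℕ → ℚ
pairwiseTerm k = (ℕ→ℚ (2 ^ k) * ℕ→ℚ k - ℕ→ℚ (2 ^ k)) + ℕ→ℚ 1

Hexp-step : ∀ {n k} → k ≢ n →
  Hexp (suc n) (suc k) ≡ Hexp n (suc k) + Hexp n k + ℕ→ℚ (2 ^ n) + hbitTerm (suc k)
Hexp-step k≢n rewrite ≢⇒≡ᵇ-false k≢n = refl

Qexp-step : ∀ {n k} → k ≢ n →
  Qexp (suc n) (suc k) ≡ Qexp n (suc k) + Qexp n k + ℕ→ℚ (2 ^ n) + pairwiseTerm (suc k)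
Qexp-step k≢n rewrite ≢⇒≡ᵇ-false k≢n = refl

gapClosedForm : ℕ → ℚ
gapClosedForm n = (ℕ→ℚ (2 ^ n) * (ℕ→ℚ n - ℕ→ℚ 4)) * (+ 1 / 2) + ℕ→ℚ n + ℕ→ℚ 2

gapClosedForm-suc : ∀ k → gapClosedForm (suc k) ≡ gapClosedForm k + (pairwiseTerm k - hbitTerm k)
gapClosedForm-suc k = begin
  gapClosedForm (suc k)
    ≡⟨ cong₂ (λ a b → (a * (b - ℕ→ℚ 4)) * (+ 1 / 2) + b + ℕ→ℚ 2) (ℕ→ℚ-* 2 (2 ^ k)) (ℕ→ℚ-+ 1 k) ⟩
  ((ℕ→ℚ 2 * P) * ((ℕ→ℚ 1 + S) - ℕ→ℚ 4)) * (+ 1 / 2) + (ℕ→ℚ 1 + S) + ℕ→ℚ 2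
    ≡⟨ solve 2 (λ P S →
         ((con (ℕ→ℚ 2) :* P) :* ((con (ℕ→ℚ 1) :+ S) :- con (ℕ→ℚ 4))) :* con (+ 1 / 2)
           :+ (con (ℕ→ℚ 1) :+ S) :+ con (ℕ→ℚ 2)
         := (P :* (S :- con (ℕ→ℚ 4))) :* con (+ 1 / 2) :+ S :+ con (ℕ→ℚ 2)
           :+ (((P :* S :- P) :+ con (ℕ→ℚ 1)) :- (P :* S) :* con (+ 1 / 2))) refl P S ⟩
  gapClosedForm k + (pairwiseTerm k - hbitTerm k) ∎
  where
  P S : ℚ
  P = ℕ→ℚ (2 ^ k)
  S = ℕ→ℚ k

sub-cancel : ∀ a q h p x y → (a + q + p + x) - (a + h + p + y) ≡ (q - h) + (x - y)
sub-cancel = solve 6 (λ a q h p x y →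
  (a :+ q :+ p :+ x) :- (a :+ h :+ p :+ y) := (q :- h) :+ (x :- y)) refl

Qexp-Hexp-half : ∀ j → Qexp (suc j) j - Hexp (suc j) j ≡ gapClosedForm (suc j)
Qexp-Hexp-half zero    = refl
Qexp-Hexp-half (suc j) = begin
  Qexp (suc (suc j)) (suc j) - Hexp (suc (suc j)) (suc j)
    ≡⟨ cong₂ _-_ (Qexp-step j≢1+j) (Hexp-step j≢1+j) ⟩
  (Qexp m m + Qexp m j + P + pairwiseTerm m) - (Hexp m m + Hexp m j + P + hbitTerm m)
    ≡⟨ cong (λ d → (d + Qexp m j + P + pairwiseTerm m) - (Hexp m m + Hexp m j + P + hbitTerm m))
            (Qexp-diagonal≡Hexp-diagonal m) ⟩
  (Hexp m m + Qexp m j + P + pairwiseTerm m) - (Hexp m m + Hexp m j + P + hbitTerm m)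
    ≡⟨ sub-cancel (Hexp m m) (Qexp m j) (Hexp m j) P (pairwiseTerm m) (hbitTerm m) ⟩
  (Qexp m j - Hexp m j) + (pairwiseTerm m - hbitTerm m)
    ≡⟨ cong (_+ (pairwiseTerm m - hbitTerm m)) (Qexp-Hexp-half j) ⟩
  gapClosedForm m + (pairwiseTerm m - hbitTerm m)
    ≡⟨ sym (gapClosedForm-suc m) ⟩
  gapClosedForm (suc m) ∎
  where
  m : ℕ
  m = suc j
  P : ℚ
  P = ℕ→ℚ (2 ^ m)
  j≢1+j : j ≢ suc j
  j≢1+j = ℕ.<⇒≢ (ℕ.n<1+n j)

corollary1 : (n : ℕ) → 1 ≤ n →
    Qexp n (n ∸ 1) - Hexp n (n ∸ 1)
      ≡ (ℕ→ℚ (2 ^ n) * (ℕ→ℚ n - ℕ→ℚ 4)) * (+ 1 / 2) + ℕ→ℚ n + ℕ→ℚ 2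
corollary1 (suc j) (s≤s _) = Qexp-Hexp-half j
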